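{- Let $k$ be even, let $\mathbf{a}=(a_1,\dots,a_k)$ be integers with $a_1<\cdots<a_k$, and let $c_i=\prod_{j\ne i}(a_i-a_j)$ for $1\le i\le k$. Let $f\colon[k]\to[k]$ be a pairing of $\mathbf{a}$. Then at least one of the following holds: (1) there exist $1\le i_1<i_2<i_3<i_4\le k$ with $f(i_1)=i_3$ and $f(i_2)=i_4$; (2) there exist $1\le i_1<i_2<i_3<i_4\le k$ with $f(i_1)=i_4$, $f(i_2)=i_3$ and $a_{i_1}+a_{i_4}\ne a_{i_2}+a_{i_3}$; (3) $\mathbf{a}$ is symmetric and $f(i)=k+1-i$ for all $i$.
   Context: A pairing of $\mathbf{a}$ is a map $f\colon[k]\to[k]$ with $f(f(i))=i$ and $f(i)\ne i$ for all $i$, and $c_i=-c_{f(i)}$ for all $i\in[k]$. $\mathbf{a}$ is symmetric if $a_1+a_k=a_2+a_{k-1}=a_3+a_{k-2}=\cdots$. -}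

module Defs where

open import Data.Nat using (ℕ; _*_)
open import Data.Fin using (Fin; _<_; opposite)
open import Data.Integer as ℤ using (ℤ; _-_; _+_)
open import Data.List using (List; foldr; filter; allFin; map)
open import Data.Fin.Properties using (_≟_)
open import Data.Product using (Σ; _×_; ∃)
open import Relation.Binary.PropositionalEquality using (_≡_; _≢_)
open import Relation.Nullary using (¬_; ¬?)

Even : ℕ → Set
Even k = ∃ λ m → k ≡ 2 * m

prodℤ : List ℤ → ℤ
prodℤ = foldr ℤ._*_ (ℤ.+ 1)

-- Indices [k] = {1,…,k} are represented by Fin k = {0,…,k-1}.
StrictlyIncreasing : ∀ {k} → (Fin k → ℤ) → Set
StrictlyIncreasing {k} a = ∀ (i j : Fin k) → i < j → a i ℤ.< a j

c : ∀ {k} → (Fin k → ℤ) → Fin k → ℤ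
c {k} a i = prodℤ (map (λ j → a i - a j) (filter (λ j → ¬? (j ≟ i)) (allFin k)))

IsPairing : ∀ {k} → (Fin k → ℤ) → (Fin k → Fin k) → Set
IsPairing a f =
  (∀ i → f (f i) ≡ i) × (∀ i → f i ≢ i) × (∀ i → c a i ≡ ℤ.- c a (f i))

-- a is symmetric: a_1 + a_k = a_2 + a_{k-1} = …  (opposite i corresponds to k+1-i)
Symmetric : ∀ {k} → (Fin k → ℤ) → Set
Symmetric a = ∀ i j → a i + a (opposite i) ≡ a j + a (opposite j)

-- Suppose f has neither a crossing nor an unbalanced nesting; we show f i = k+1−i
-- by strong induction on i.  If f i = j ≠ k+1−i, the induction hypothesis forces
-- i < j < k+1−i.  Let ψ fix the indices m with j < m ≤ k+1−i and send every other
-- m to f m.  Then ψ is an involution and |a_j − a_{ψ m}| ≤ |a_i − a_m| for all m: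
-- outside the window the balanced nestings give a_i + a_j = a_m + a_{f m}, and
-- inside it a_i < a_j < a_m.  The inequality is strict at m = k+1−i, so
-- |c_j| < |c_i|, contradicting c_i = −c_j.  Once f is the reversal, any two pairs
-- (i, k+1−i) are nested, so balance is exactly symmetry of a.
module Submission where

open import Defs
open import Data.Nat using (ℕ)
open import Data.Fin using (Fin; _<_; opposite)
open import Data.Integer using (ℤ; _+_)
open import Data.Product using (Σ; _×_; ∃)
open import Data.Sum using (_⊎_)
open import Relation.Binary.PropositionalEquality using (_≡_; _≢_)

import Data.Nat as ℕ
import Data.Nat.Properties as ℕP
import Data.Integer as ℤ
import Data.Integer.Properties as ℤP
import Data.Fin as F
import Data.Fin.Properties as FP
import Algebra.Properties.CommutativeMonoid.Sum as CommutativeMonoidSum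
open import Algebra.Definitions using (Involutive)
open import Data.Fin.Induction using (<-wellFounded)
open import Data.Fin.Permutation using (permutation)
open import Data.Integer.Solver using (module +-*-Solver)
open import Data.List using ([]; _∷_; filter; allFin; map; tabulate)
open import Data.List.Properties using (map-tabulate)
open import Data.List.Membership.Propositional using (_∈_)
open import Data.List.Membership.Propositional.Properties using (∈-allFin)
open import Data.List.Relation.Unary.Any using (here; there)
open import Data.Nat.ListAction using (product)
open import Data.Product using (_,_)
open import Data.Sum using (inj₁; inj₂)
open import Data.Empty using (⊥; ⊥-elim)
open import Function using (_∘_; id)
open import Induction.WellFounded using (module All)
open import Relation.Binary using (tri<; tri≈; tri>)
open import Relation.Binary.PropositionalEquality
  using (refl; sym; trans; cong; cong₂; subst; subst₂; module ≡-Reasoning)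
open import Relation.Nullary using (¬_; Dec; yes; no; ¬?)
open import Relation.Nullary.Decidable using (_×-dec_)

module Π = CommutativeMonoidSum ℕP.*-1-commutativeMonoid

product-allFin : ∀ {n} (h : Fin n → ℕ) → product (map h (allFin n)) ≡ Π.sum h
product-allFin {n} h = trans (cong product (map-tabulate id h)) (product-tabulate h)
  where
  product-tabulate : ∀ {n} (h : Fin n → ℕ) → product (tabulate h) ≡ Π.sum h
  product-tabulate {ℕ.zero}  h = refl
  product-tabulate {ℕ.suc n} h = cong (h F.zero ℕ.*_) (product-tabulate (h ∘ F.suc))

product-∘-involution : ∀ {n} (h : Fin n → ℕ) {ψ : Fin n → Fin n} → Involutive _≡_ ψ →
  product (map (h ∘ ψ) (allFin n)) ≡ product (map h (allFin n))
product-∘-involution {n} h {ψ} ψ-invol = begin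
  product (map (h ∘ ψ) (allFin n))  ≡⟨ product-allFin (h ∘ ψ) ⟩
  Π.sum (h ∘ ψ)                     ≡⟨ Π.sum-permute h (permutation ψ ψ ψ-invol ψ-invol) ⟨
  Π.sum h                           ≡⟨ product-allFin h ⟨
  product (map h (allFin n))        ∎
  where open ≡-Reasoning

module _ {A : Set} {g h : A → ℕ} where

  product-positive : (∀ x → 0 ℕ.< g x) → ∀ xs → 0 ℕ.< product (map g xs)
  product-positive g>0 []       = ℕP.0<1+n
  product-positive g>0 (x ∷ xs) = ℕP.*-mono-< (g>0 x) (product-positive g>0 xs)

  product-mono-≤ : (∀ x → g x ℕ.≤ h x) → ∀ xs → product (map g xs) ℕ.≤ product (map h xs)
  product-mono-≤ g≤h []       = ℕP.≤-refl
  product-mono-≤ g≤h (x ∷ xs) = ℕP.*-mono-≤ (g≤h x) (product-mono-≤ g≤h xs)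

  product-mono-< : (∀ x → 0 ℕ.< g x) → (∀ x → g x ℕ.≤ h x) →
    ∀ {x xs} → x ∈ xs → g x ℕ.< h x → product (map g xs) ℕ.< product (map h xs)
  product-mono-< g>0 g≤h {xs = x ∷ xs} (here refl) gx<hx = ℕP.<-≤-trans
    (ℕP.*-monoˡ-< (product (map g xs)) {{ℕ.>-nonZero (product-positive g>0 xs)}} gx<hx)
    (ℕP.*-monoʳ-≤ (h x) (product-mono-≤ g≤h xs))
  product-mono-< g>0 g≤h {xs = y ∷ xs} (there x∈xs) gx<hx = ℕP.<-≤-trans
    (ℕP.*-monoʳ-< (g y) {{ℕ.>-nonZero (g>0 y)}} (product-mono-< g>0 g≤h x∈xs gx<hx))
    (ℕP.*-monoˡ-≤ (product (map h xs)) (g≤h y))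

+∣i-j∣≡j-i : ∀ {i j} → i ℤ.≤ j → ℤ.+ ℤ.∣ i ℤ.- j ∣ ≡ j ℤ.- i
+∣i-j∣≡j-i {i} {j} i≤j =
  trans (cong ℤ.+_ (ℤP.∣i-j∣≡∣j-i∣ i j)) (ℤP.0≤i⇒+∣i∣≡i (ℤP.i≤j⇒0≤j-i i≤j))

i<j<k⇒∣j-k∣<∣i-k∣ : ∀ {i j k} → i ℤ.< j → j ℤ.< k → ℤ.∣ j ℤ.- k ∣ ℕ.< ℤ.∣ i ℤ.- k ∣
i<j<k⇒∣j-k∣<∣i-k∣ {i} {j} {k} i<j j<k = ℤP.drop‿+<+ (subst₂ ℤ._<_
  (sym (+∣i-j∣≡j-i (ℤP.<⇒≤ j<k))) (sym (+∣i-j∣≡j-i (ℤP.<⇒≤ (ℤP.<-trans i<j j<k))))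
  (ℤP.+-monoʳ-< k (ℤP.neg-mono-< i<j)))

i+j≡k+l⇒∣j-l∣≡∣i-k∣ : ∀ i j k l → i + j ≡ k + l → ℤ.∣ j ℤ.- l ∣ ≡ ℤ.∣ i ℤ.- k ∣
i+j≡k+l⇒∣j-l∣≡∣i-k∣ i j k l eq = trans (cong ℤ.∣_∣ j-l≡k-i) (ℤP.∣i-j∣≡∣j-i∣ k i)
  where
  open +-*-Solver
  j-l≡k-i : j ℤ.- l ≡ k ℤ.- i
  j-l≡k-i = begin
    j ℤ.- l                ≡⟨ solve 4 (λ i j k l → j :- l := (i :+ j) :- (i :+ l)) refl i j k l ⟩
    (i + j) ℤ.- (i + l)    ≡⟨ cong (ℤ._- (i + l)) eq ⟩
    (k + l) ℤ.- (i + l)    ≡⟨ solve 4 (λ i j k l → (k :+ l) :- (i :+ l) := k :- i) refl i j k l ⟩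
    k ℤ.- i                ∎
    where open ≡-Reasoning

module _ {k : ℕ} where

  opposite-reverses-< : ∀ {i j : Fin k} → i < j → opposite j < opposite i
  opposite-reverses-< {i} {j} i<j
    rewrite FP.opposite-prop i | FP.opposite-prop j = ℕP.∸-monoʳ-< (ℕ.s≤s i<j) (FP.toℕ<n j)

  opposite-<-flip : ∀ {i j : Fin k} → opposite i < j → opposite j < i
  opposite-<-flip {i} oi<j = subst (_ <_) (FP.opposite-involutive i) (opposite-reverses-< oi<j)

  strictlyIncreasing⇒injective : ∀ {a : Fin k → ℤ} → StrictlyIncreasing a →
    ∀ {x y} → a x ≡ a y → x ≡ y
  strictlyIncreasing⇒injective inc {x} {y} ax≡ay with FP.<-cmp x y
  ... | tri< x<y _ _ = ⊥-elim (ℤP.<-irrefl ax≡ay (inc x y x<y))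
  ... | tri≈ _ x≡y _ = x≡y
  ... | tri> _ _ y<x = ⊥-elim (ℤP.<-irrefl (sym ax≡ay) (inc y x y<x))

  -- The factor at m = x is 1 so that |c_x| is the product of gap a x over all m.
  gap : (Fin k → ℤ) → Fin k → Fin k → ℕ
  gap a x m with m FP.≟ x
  ... | yes _ = 1
  ... | no  _ = ℤ.∣ a x ℤ.- a m ∣

  gap-self : ∀ a x → gap a x x ≡ 1
  gap-self a x with x FP.≟ x
  ... | yes _   = refl
  ... | no  x≢x = ⊥-elim (x≢x refl)

  gap-≢ : ∀ a {x m} → m ≢ x → gap a x m ≡ ℤ.∣ a x ℤ.- a m ∣
  gap-≢ a {x} {m} m≢x with m FP.≟ x
  ... | yes m≡x = ⊥-elim (m≢x m≡x)
  ... | no  _   = refl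

  gap-positive : ∀ {a} → StrictlyIncreasing a → ∀ x m → 0 ℕ.< gap a x m
  gap-positive {a} inc x m with m FP.≟ x
  ... | yes _   = ℕP.0<1+n
  ... | no  m≢x = ℕP.n≢0⇒n>0 λ gap≡0 →
    m≢x (sym (strictlyIncreasing⇒injective inc (ℤP.i-j≡0⇒i≡j _ _ (ℤP.∣i∣≡0⇒i≡0 gap≡0))))

  ∣c∣≡product-gap : ∀ a x → ℤ.∣ c a x ∣ ≡ product (map (gap a x) (allFin k))
  ∣c∣≡product-gap a x = go (allFin k)
    where
    go : ∀ ms → ℤ.∣ prodℤ (map (λ m → a x ℤ.- a m) (filter (λ m → ¬? (m FP.≟ x)) ms)) ∣
                ≡ product (map (gap a x) ms)
    go [] = refl
    go (m ∷ ms) with m FP.≟ x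
    ... | yes _ = trans (go ms) (sym (ℕP.+-identityʳ _))
    ... | no  _ = trans (ℤP.abs-* (a x ℤ.- a m) _) (cong (ℤ.∣ a x ℤ.- a m ∣ ℕ.*_) (go ms))

  Crossing : (Fin k → Fin k) → Set
  Crossing f = ∃ λ i₁ → ∃ λ i₂ → ∃ λ i₃ → ∃ λ i₄ →
    i₁ < i₂ × i₂ < i₃ × i₃ < i₄ × f i₁ ≡ i₃ × f i₂ ≡ i₄

  UnbalancedNesting : (Fin k → ℤ) → (Fin k → Fin k) → Set
  UnbalancedNesting a f = ∃ λ i₁ → ∃ λ i₂ → ∃ λ i₃ → ∃ λ i₄ →
    i₁ < i₂ × i₂ < i₃ × i₃ < i₄ × f i₁ ≡ i₄ × f i₂ ≡ i₃ × a i₁ + a i₄ ≢ a i₂ + a i₃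

  crossing? : ∀ f → Dec (Crossing f)
  crossing? f = FP.any? λ i₁ → FP.any? λ i₂ → FP.any? λ i₃ → FP.any? λ i₄ →
    (i₁ FP.<? i₂) ×-dec (i₂ FP.<? i₃) ×-dec (i₃ FP.<? i₄)
    ×-dec (f i₁ FP.≟ i₃) ×-dec (f i₂ FP.≟ i₄)

  unbalancedNesting? : ∀ a f → Dec (UnbalancedNesting a f)
  unbalancedNesting? a f = FP.any? λ i₁ → FP.any? λ i₂ → FP.any? λ i₃ → FP.any? λ i₄ →
    (i₁ FP.<? i₂) ×-dec (i₂ FP.<? i₃) ×-dec (i₃ FP.<? i₄)
    ×-dec (f i₁ FP.≟ i₄) ×-dec (f i₂ FP.≟ i₃) ×-dec ¬? (a i₁ + a i₄ ℤ.≟ a i₂ + a i₃)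

  pairSum : (Fin k → ℤ) → Fin k → ℤ
  pairSum a i = a i + a (opposite i)

  pairSum-opposite : ∀ a i → pairSum a (opposite i) ≡ pairSum a i
  pairSum-opposite a i =
    trans (cong (λ x → a (opposite i) + a x) (FP.opposite-involutive i)) (ℤP.+-comm _ (a i))

module NonCrossingBalanced {k : ℕ} {a : Fin k → ℤ} (a-inc : StrictlyIncreasing a)
  {f : Fin k → Fin k} (f-invol : ∀ i → f (f i) ≡ i) (f-nofix : ∀ i → f i ≢ i)
  (c-antisym : ∀ i → c a i ≡ ℤ.- c a (f i))
  (noCrossing : ¬ Crossing f) (noUnbalanced : ¬ UnbalancedNesting a f) where

  f-injective : ∀ {x y} → f x ≡ f y → x ≡ y
  f-injective {x} {y} fx≡fy = trans (sym (f-invol x)) (trans (cong f fx≡fy) (f-invol y))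

  f-swap : ∀ {x y} → f x ≡ y → f y ≡ x
  f-swap {x} refl = f-invol x

  nested-balanced : ∀ {i₁ i₂ i₃ i₄} → i₁ < i₂ → i₂ < i₃ → i₃ < i₄ →
    f i₁ ≡ i₄ → f i₂ ≡ i₃ → a i₁ + a i₄ ≡ a i₂ + a i₃
  nested-balanced {i₁} {i₂} {i₃} {i₄} i₁<i₂ i₂<i₃ i₃<i₄ fi₁ fi₂
    with a i₁ + a i₄ ℤ.≟ a i₂ + a i₃
  ... | yes balanced = balanced
  ... | no unbalanced =
    ⊥-elim (noUnbalanced (i₁ , i₂ , i₃ , i₄ , i₁<i₂ , i₂<i₃ , i₃<i₄ , fi₁ , fi₂ , unbalanced))

  module InductionStep (i : Fin k) (IH : ∀ {p} → p < i → f p ≡ opposite p)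
                       (fi≢oi : f i ≢ opposite i) where

    j : Fin k
    j = f i

    pairedBelow : ∀ {m} → opposite m < i → f m ≡ opposite m
    pairedBelow {m} om<i = f-swap (trans (IH om<i) (FP.opposite-involutive m))

    i≢oj : i ≢ opposite j
    i≢oj i≡oj = fi≢oi (sym (trans (cong opposite i≡oj) (FP.opposite-involutive j)))

    i<j : i < j
    i<j with FP.<-cmp i j
    ... | tri< i<j _ _ = i<j
    ... | tri≈ _ i≡j _ = ⊥-elim (f-nofix i (sym i≡j))
    ... | tri> _ _ j<i = ⊥-elim (i≢oj (trans (sym (f-invol i)) (IH j<i)))

    j<oi : j < opposite i
    j<oi with FP.<-cmp j (opposite i)
    ... | tri< j<oi _ _ = j<oi
    ... | tri≈ _ j≡oi _ = ⊥-elim (fi≢oi j≡oi)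
    ... | tri> _ _ oi<j =
      ⊥-elim (i≢oj (trans (sym (f-invol i)) (pairedBelow (opposite-<-flip oi<j))))

    Window : Fin k → Set
    Window m = j < m × m F.≤ opposite i

    window? : ∀ m → Dec (Window m)
    window? m = (j FP.<? m) ×-dec (m FP.≤? opposite i)

    window-closed : ∀ m → Window (f m) → Window m
    window-closed m (j<fm , fm≤oi) with FP.<-cmp m i
    ... | tri< m<i _ _ = ⊥-elim (ℕP.<⇒≱ (subst (opposite i <_) (sym (IH m<i))
                                            (opposite-reverses-< m<i)) fm≤oi)
    ... | tri≈ _ refl _ = ⊥-elim (FP.<-irrefl refl j<fm)
    ... | tri> _ _ i<m with FP.<-cmp m j
    ...   | tri< m<j _ _ = ⊥-elim (noCrossing (i , m , j , f m , i<m , m<j , j<fm , refl , refl))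
    ...   | tri≈ _ refl _ = ⊥-elim (FP.<-asym i<j (subst (j <_) (f-invol i) j<fm))
    ...   | tri> _ _ j<m with m FP.≤? opposite i
    ...     | yes m≤oi = j<m , m≤oi
    ...     | no m≰oi = ⊥-elim (FP.<-asym (FP.<-trans i<j j<fm)
                          (subst (_< i) (sym (pairedBelow om<i)) om<i))
      where
      om<i : opposite m < i
      om<i = opposite-<-flip (ℕP.≰⇒> m≰oi)

    ψ : Fin k → Fin k
    ψ m with window? m
    ... | yes _ = m
    ... | no  _ = f m

    ψ-window : ∀ {m} → Window m → ψ m ≡ m
    ψ-window {m} m∈W with window? m
    ... | yes _    = refl
    ... | no  m∉W = ⊥-elim (m∉W m∈W)

    ψ-outside : ∀ {m} → ¬ Window m → ψ m ≡ f m
    ψ-outside {m} m∉W with window? m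
    ... | yes m∈W = ⊥-elim (m∉W m∈W)
    ... | no  _   = refl

    ψ-involutive : Involutive _≡_ ψ
    ψ-involutive m = by-cases (window? m)
      where
      by-cases : Dec (Window m) → ψ (ψ m) ≡ m
      by-cases (yes m∈W) = trans (cong ψ (ψ-window m∈W)) (ψ-window m∈W)
      by-cases (no m∉W)  = trans (cong ψ (ψ-outside m∉W))
        (trans (ψ-outside (m∉W ∘ window-closed m)) (f-invol m))

    outer-balanced : ∀ {p} → p < i → a i + a j ≡ a p + a (f p)
    outer-balanced {p} p<i = subst (λ q → a i + a j ≡ a p + a q) (sym (IH p<i))
      (sym (nested-balanced p<i i<j (FP.<-trans j<oi (opposite-reverses-< p<i)) (IH p<i) refl))

    inner-balanced : ∀ {m} → i < m → m < j → a i + a j ≡ a m + a (f m)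
    inner-balanced {m} i<m m<j with FP.<-cmp m (f m)
    ... | tri< m<fm _ _ = nested-balanced i<m m<fm fm<j refl refl
      where
      fm<j : f m < j
      fm<j with FP.<-cmp (f m) j
      ... | tri< fm<j _ _ = fm<j
      ... | tri≈ _ fm≡j _ = ⊥-elim (FP.<-irrefl (sym (f-injective fm≡j)) i<m)
      ... | tri> _ _ j<fm = ⊥-elim (noCrossing (i , m , j , f m , i<m , m<j , j<fm , refl , refl))
    ... | tri≈ _ m≡fm _ = ⊥-elim (f-nofix m (sym m≡fm))
    ... | tri> _ _ fm<m = trans (nested-balanced i<fm fm<m m<j refl (f-invol m))
                               (ℤP.+-comm (a (f m)) (a m))
      where
      i<fm : i < f m
      i<fm with FP.<-cmp i (f m)
      ... | tri< i<fm _ _ = i<fm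
      ... | tri≈ _ i≡fm _ = ⊥-elim (FP.<-irrefl (sym (trans (cong f i≡fm) (f-invol m))) m<j)
      ... | tri> _ _ fm<i = ⊥-elim (FP.<-asym (FP.<-trans m<j j<oi)
              (subst (opposite i <_) (sym m≡ofm) (opposite-reverses-< fm<i)))
        where
        m≡ofm : m ≡ opposite (f m)
        m≡ofm = trans (sym (f-invol m)) (IH fm<i)

    balanced-outside : ∀ {m} → ¬ Window m → m ≢ i → m ≢ j → a i + a j ≡ a m + a (f m)
    balanced-outside {m} m∉W m≢i m≢j with FP.<-cmp m i
    ... | tri< m<i _ _  = outer-balanced m<i
    ... | tri≈ _ m≡i _ = ⊥-elim (m≢i m≡i)
    ... | tri> _ _ i<m with FP.<-cmp m j
    ...   | tri< m<j _ _  = inner-balanced i<m m<j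
    ...   | tri≈ _ m≡j _ = ⊥-elim (m≢j m≡j)
    ...   | tri> _ _ j<m = begin
      a i + a j                           ≡⟨ outer-balanced om<i ⟩
      a (opposite m) + a (f (opposite m)) ≡⟨ cong₂ (λ x y → a x + a y) (sym (f-swap fom≡m)) fom≡m ⟩
      a (f m) + a m                       ≡⟨ ℤP.+-comm (a (f m)) (a m) ⟩
      a m + a (f m)                       ∎
      where
      open ≡-Reasoning
      om<i : opposite m < i
      om<i with m FP.≤? opposite i
      ... | yes m≤oi = ⊥-elim (m∉W (j<m , m≤oi))
      ... | no  m≰oi = opposite-<-flip (ℕP.≰⇒> m≰oi)
      fom≡m : f (opposite m) ≡ m
      fom≡m = trans (IH om<i) (FP.opposite-involutive m)

    gap-outside : ∀ {m} → ¬ Window m → gap a j (f m) ≡ gap a i m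
    gap-outside {m} m∉W = by-cases (m FP.≟ i) (m FP.≟ j)
      where
      open ≡-Reasoning
      by-cases : Dec (m ≡ i) → Dec (m ≡ j) → gap a j (f m) ≡ gap a i m
      by-cases (yes refl) _ = trans (gap-self a j) (sym (gap-self a i))
      by-cases (no _) (yes refl) = begin
        gap a j (f j)            ≡⟨ cong (gap a j) (f-invol i) ⟩
        gap a j i                ≡⟨ gap-≢ a (FP.<⇒≢ i<j) ⟩
        ℤ.∣ a j ℤ.- a i ∣        ≡⟨ ℤP.∣i-j∣≡∣j-i∣ (a j) (a i) ⟩
        ℤ.∣ a i ℤ.- a j ∣        ≡⟨ gap-≢ a (FP.<⇒≢ i<j ∘ sym) ⟨
        gap a i j                ∎
      by-cases (no m≢i) (no m≢j) = begin
        gap a j (f m)            ≡⟨ gap-≢ a (m≢i ∘ f-injective) ⟩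
        ℤ.∣ a j ℤ.- a (f m) ∣    ≡⟨ i+j≡k+l⇒∣j-l∣≡∣i-k∣ (a i) (a j) (a m) (a (f m))
                                      (balanced-outside m∉W m≢i m≢j) ⟩
        ℤ.∣ a i ℤ.- a m ∣        ≡⟨ gap-≢ a m≢i ⟨
        gap a i m                ∎

    gap-window : ∀ {m} → Window m → gap a j m ℕ.< gap a i m
    gap-window {m} (j<m , _) = subst₂ ℕ._<_
      (sym (gap-≢ a (FP.<⇒≢ j<m ∘ sym))) (sym (gap-≢ a (FP.<⇒≢ i<m ∘ sym)))
      (i<j<k⇒∣j-k∣<∣i-k∣ (a-inc i j i<j) (a-inc j m j<m))
      where
      i<m : i < m
      i<m = FP.<-trans i<j j<m

    gap-ψ-≤ : ∀ m → gap a j (ψ m) ℕ.≤ gap a i m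
    gap-ψ-≤ m with window? m
    ... | yes m∈W = ℕP.<⇒≤ (gap-window m∈W)
    ... | no  m∉W = ℕP.≤-reflexive (gap-outside m∉W)

    impossible : ⊥
    impossible = ℕP.<-irrefl ∣cj∣≡∣ci∣ ∣cj∣<∣ci∣
      where
      ∣cj∣≡∣ci∣ : product (map (gap a j) (allFin k)) ≡ product (map (gap a i) (allFin k))
      ∣cj∣≡∣ci∣ = begin
        product (map (gap a j) (allFin k)) ≡⟨ ∣c∣≡product-gap a j ⟨
        ℤ.∣ c a j ∣                        ≡⟨ ℤP.∣-i∣≡∣i∣ (c a j) ⟨
        ℤ.∣ ℤ.- c a j ∣                    ≡⟨ cong ℤ.∣_∣ (c-antisym i) ⟨
        ℤ.∣ c a i ∣                        ≡⟨ ∣c∣≡product-gap a i ⟩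
        product (map (gap a i) (allFin k)) ∎
        where open ≡-Reasoning
      ∣cj∣<∣ci∣ : product (map (gap a j) (allFin k)) ℕ.< product (map (gap a i) (allFin k))
      ∣cj∣<∣ci∣ = subst (ℕ._< _) (product-∘-involution (gap a j) {ψ} ψ-involutive)
        (product-mono-< (gap-positive a-inc j ∘ ψ) gap-ψ-≤ (∈-allFin (opposite i))
          (subst (λ q → gap a j q ℕ.< _) (sym (ψ-window oi∈W)) (gap-window oi∈W)))
        where
        oi∈W : Window (opposite i)
        oi∈W = j<oi , FP.≤-refl

  f≡opposite : ∀ i → f i ≡ opposite i
  f≡opposite = All.wfRec <-wellFounded _ (λ i → f i ≡ opposite i) step
    where
    step : ∀ i → (∀ {p} → p < i → f p ≡ opposite p) → f i ≡ opposite i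
    step i IH with f i FP.≟ opposite i
    ... | yes fi≡oi = fi≡oi
    ... | no  fi≢oi = ⊥-elim (InductionStep.impossible i IH fi≢oi)

  pairSum-nested : ∀ {l m} → l < m → m < opposite m → pairSum a l ≡ pairSum a m
  pairSum-nested l<m m<om =
    nested-balanced l<m m<om (opposite-reverses-< l<m) (f≡opposite _) (f≡opposite _)

  pairSum-lowerHalf : ∀ {l m} → l < opposite l → m < opposite m → pairSum a l ≡ pairSum a m
  pairSum-lowerHalf {l} {m} l<ol m<om with FP.<-cmp l m
  ... | tri< l<m _ _  = pairSum-nested l<m m<om
  ... | tri≈ _ refl _ = refl
  ... | tri> _ _ m<l = sym (pairSum-nested m<l l<ol)

  lowerHalf : ∀ i → ∃ λ l → l < opposite l × pairSum a i ≡ pairSum a l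
  lowerHalf i with FP.<-cmp i (opposite i)
  ... | tri< i<oi _ _  = i , i<oi , refl
  ... | tri≈ _ i≡oi _ = ⊥-elim (f-nofix i (trans (f≡opposite i) (sym i≡oi)))
  ... | tri> _ _ oi<i =
    opposite i , subst (opposite i <_) (sym (FP.opposite-involutive i)) oi<i ,
    sym (pairSum-opposite a i)

  symmetric : Symmetric a
  symmetric i j with lowerHalf i | lowerHalf j
  ... | l , l<ol , i~l | m , m<om , j~m =
    trans i~l (trans (pairSum-lowerHalf l<ol m<om) (sym j~m))

lemma7p13 : (k : ℕ) → Even k → (a : Fin k → ℤ) → StrictlyIncreasing a →
    (f : Fin k → Fin k) → IsPairing a f →
    (∃ λ i₁ → ∃ λ i₂ → ∃ λ i₃ → ∃ λ i₄ →
        i₁ < i₂ × i₂ < i₃ × i₃ < i₄ × f i₁ ≡ i₃ × f i₂ ≡ i₄)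
    ⊎ ((∃ λ i₁ → ∃ λ i₂ → ∃ λ i₃ → ∃ λ i₄ →
        i₁ < i₂ × i₂ < i₃ × i₃ < i₄ × f i₁ ≡ i₄ × f i₂ ≡ i₃
          × a i₁ + a i₄ ≢ a i₂ + a i₃)
    ⊎ (Symmetric a × (∀ i → f i ≡ opposite i)))
lemma7p13 k _ a a-inc f (f-invol , f-nofix , c-antisym)
  with crossing? f | unbalancedNesting? a f
... | yes crossing | _              = inj₁ crossing
... | no _         | yes unbalanced = inj₂ (inj₁ unbalanced)
... | no noCrossing | no noUnbalanced = inj₂ (inj₂ (symmetric , f≡opposite))
  where open NonCrossingBalanced a-inc f-invol f-nofix c-antisym noCrossing noUnbalanced
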